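{- Let $(a,b;c)$ and $(r,s;t)$ be two triples of rational numbers such that (i) none of $a$, $b$, $c$, $a-c$, $b-c$ is an integer, and (ii) $a-r$, $b-s$, $c-t$ are all integers. Then for each prime $p$, the series ${}_2F_1(a,b;c;z)$ has $p$-adically unbounded coefficients if and only if ${}_2F_1(r,s;t;z)$ has $p$-adically unbounded coefficients.
   Context: ${}_2F_1(a,b;c;z)=\sum_{m\ge0}\frac{(a)_m(b)_m}{(c)_m}\frac{z^m}{m!}$ with $(x)_0=1$, $(x)_m=x(x+1)\cdots(x+m-1)$. A power series with rational coefficients $A_m$ has $p$-adically unbounded coefficients if $\inf_m v_p(A_m)=-\infty$, i.e. arbitrarily high powers of $p$ occur in the denominators of the coefficients. -}

module Defs where

open import Data.Nat as ℕ using (ℕ; zero; suc; _^_)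
open import Data.Nat.Divisibility using (_∣_)
open import Data.Integer as ℤ using (ℤ; +_)
open import Data.Rational using (ℚ; _+_; _-_; _*_; 1/_; 0ℚ; 1ℚ; _/_; ↧ₙ_; ≢-nonZero)
open import Data.Rational.Properties using (_≟_)
open import Data.Product using (∃-syntax)
open import Relation.Nullary using (yes; no)
open import Relation.Binary.PropositionalEquality using (_≡_)

ι : ℕ → ℚ
ι n = + n / 1

IsInt : ℚ → Set
IsInt x = ∃[ z ] x ≡ z / 1

-- total reciprocal (1/0 := 0); only ever applied to nonzero values
-- under the hypotheses of the theorem
inv : ℚ → ℚ
inv x with x ≟ 0ℚ
... | yes _ = 0ℚ
... | no ne = 1/_ x {{≢-nonZero ne}}

poch : ℚ → ℕ → ℚ
poch x zero    = 1ℚ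
poch x (suc m) = poch x m * (x + ι m)

fact : ℕ → ℚ
fact zero    = 1ℚ
fact (suc m) = fact m * ι (suc m)

coeff2F1 : ℚ → ℚ → ℚ → ℕ → ℚ
coeff2F1 a b c m = poch a m * poch b m * inv (poch c m * fact m)

-- A rational power series (coefficients A m) has p-adically unbounded
-- coefficients: inf_m v_p(A m) = -∞, i.e. for every k some coefficient has
-- v_p ≤ -k, i.e. p^k divides its reduced denominator.
PAdicallyUnbounded : ℕ → (ℕ → ℚ) → Set
PAdicallyUnbounded p A = ∀ (k : ℕ) → ∃[ m ] (p ^ k ∣ ↧ₙ (A m))

module Submission where

-- Write w(a,b,c)(m) = v_p(A_m) for the p-adic valuation v of the m-th coefficient
-- A_m = (a)_m (b)_m / ((c)_m m!).  The coefficients have unbounded p-power denominators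
-- exactly when w is unbounded below (padicallyUnbounded⇔), so it suffices to show that
-- unboundedness of w survives a ↦ a + 1, c ↦ c + 1 (b follows from the symmetry a ↔ b),
-- and then to iterate over integer translations (IntegerTranslation).  A unit step compares
-- the two valuation sequences through the exact shift relations
--   A_m(a+1) = A_m(a) (a+m)/a,  A_m(c+1) = A_m(c) c/(c+m),
--   A_{m+1} = A_m (a+m)(b+m) / ((c+m)(m+1)).
-- One direction only needs v(x + m) ≥ min(v x, 0).  For the other, either v(a + m) is small,
-- or the ultrametric inequality forces v m ≤ v a and v(c + m - 1) ≤ v(c - a - 1), so the
-- index m - 1 coefficient of the shifted series is within a fixed constant of the index m one
-- (v-dominant); the case c + 1 → c is symmetric.  Non-integrality of a, b, c, a - c, b - c
-- keeps every factor nonzero.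

open import Defs
open import Data.Empty using (⊥-elim)
open import Data.Nat as ℕ using (ℕ; zero; suc; _^_; NonZero; _≤_; _<_)
import Data.Nat.Properties as ℕP
open import Data.Nat.Divisibility using (_∣_; _∣?_; divides; quotient; ∣-trans; m∣m*n; _∣0; ∣1⇒≡1)
import Data.Nat.Divisibility as ℕD
open import Data.Nat.Primality using (Prime; prime⇒nonZero; prime⇒nonTrivial; euclidsLemma)
open import Data.Nat.Coprimality using (Coprime; coprime?)
import Data.Nat.Tactic.RingSolver as ℕ-Solver
open import Data.Integer as ℤ using (ℤ; +_; -[1+_]; ∣_∣; +≤+; -≤+)
import Data.Integer.Properties as ℤP
import Data.Integer.Divisibility.Signed as ℤD
open import Data.Integer.GCD using (gcd-zeroʳ)
open import Data.Integer.Tactic.RingSolver using (solve-∀)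
open import Data.Rational as ℚ using (ℚ; ↥_; ↧_; ↧ₙ_; 0ℚ; 1ℚ; _/_; _+_; _-_; -_; _*_)
import Data.Rational.Properties as ℚP
open import Data.Rational.Solver using (module +-*-Solver)
open import Data.Product using (Σ; _×_; _,_; ∃-syntax)
open import Data.Sum using (_⊎_; inj₁; inj₂)
open import Function.Bundles using (_⇔_; mk⇔)
open import Function.Properties.Equivalence using (⇔-setoid)
open import Level using (0ℓ)
open import Relation.Nullary using (¬_; yes; no)
open import Relation.Nullary.Decidable using (recompute)
open import Relation.Binary.PropositionalEquality
import Relation.Binary.Reasoning.Setoid as SetoidReasoning

a+d≡b+c⇒a≡b+[c-d] : ∀ a d b c → a ℤ.+ d ≡ b ℤ.+ c → a ≡ b ℤ.+ (c ℤ.- d)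
a+d≡b+c⇒a≡b+[c-d] a d b c a+d≡b+c = trans (regroup a d) (trans (cong (ℤ._- d) a+d≡b+c) (regroup′ b c d))
  where
  regroup : ∀ a d → a ≡ (a ℤ.+ d) ℤ.- d
  regroup = solve-∀
  regroup′ : ∀ b c d → (b ℤ.+ c) ℤ.- d ≡ b ℤ.+ (c ℤ.- d)
  regroup′ = solve-∀

≤-shiftʳ : ∀ {e d a} → e ℤ.≤ a ℤ.- d → e ℤ.+ d ℤ.≤ a
≤-shiftʳ {e} {d} {a} h = subst (e ℤ.+ d ℤ.≤_) (cancel a d) (ℤP.+-monoˡ-≤ d h)
  where cancel : ∀ a d → (a ℤ.- d) ℤ.+ d ≡ a
        cancel = solve-∀

≤-shiftˡ : ∀ {e d a} → e ℤ.+ d ℤ.≤ a → e ℤ.≤ a ℤ.- d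
≤-shiftˡ {e} {d} {a} h = subst (ℤ._≤ a ℤ.- d) (cancel e d) (ℤP.+-monoˡ-≤ (ℤ.- d) h)
  where cancel : ∀ e d → (e ℤ.+ d) ℤ.- d ≡ e
        cancel = solve-∀

ℤ-*-≢0 : ∀ {i j} → i ≢ ℤ.0ℤ → j ≢ ℤ.0ℤ → i ℤ.* j ≢ ℤ.0ℤ
ℤ-*-≢0 {i} i≢0 j≢0 ij≡0 with ℤP.i*j≡0⇒i≡0∨j≡0 i ij≡0
... | inj₁ i≡0 = i≢0 i≡0
... | inj₂ j≡0 = j≢0 j≡0

≡+[s-t]⇒≡+[t-s] : ∀ x y s t → x ≡ y ℤ.+ (s ℤ.- t) → y ≡ x ℤ.+ (t ℤ.- s)
≡+[s-t]⇒≡+[t-s] x y s t x≡y+[s-t] = trans (regroup y s t) (cong (ℤ._+ (t ℤ.- s)) (sym x≡y+[s-t]))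
  where
  regroup : ∀ y s t → y ≡ (y ℤ.+ (s ℤ.- t)) ℤ.+ (t ℤ.- s)
  regroup = solve-∀

≤-abs : ∀ i → i ℤ.≤ + ∣ i ∣
≤-abs (+ n)      = ℤP.≤-refl
≤-abs -[1+ n ]   = -≤+

Unbounded : (ℕ → ℤ) → Set
Unbounded f = ∀ (k : ℕ) → ∃[ m ] f m ℤ.≤ ℤ.- + k

Unbounded-cong : ∀ {f g : ℕ → ℤ} → (∀ m → f m ≡ g m) → Unbounded f ⇔ Unbounded g
Unbounded-cong {f} {g} f≗g = mk⇔ (transport f≗g) (transport (λ m → sym (f≗g m)))
  where
  transport : ∀ {f g : ℕ → ℤ} → (∀ m → f m ≡ g m) → Unbounded f → Unbounded g
  transport f≗g f-unbounded k with f-unbounded k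
  ... | m , fm≤-k = m , subst (ℤ._≤ ℤ.- + k) (f≗g m) fm≤-k

Unbounded-transfer : ∀ {f g : ℕ → ℤ} C → (∀ m → ∃[ m′ ] g m′ ℤ.≤ f m ℤ.+ C) → Unbounded f → Unbounded g
Unbounded-transfer {f} {g} C matched f-unbounded k with f-unbounded (k ℕ.+ ∣ C ∣)
... | m , fm≤ with matched m
... | m′ , gm′≤ = m′ , (begin
  g m′                                         ≤⟨ gm′≤ ⟩
  f m ℤ.+ C                                    ≤⟨ ℤP.+-monoˡ-≤ C fm≤ ⟩
  ℤ.- + (k ℕ.+ ∣ C ∣) ℤ.+ C                    ≡⟨ cong (λ z → ℤ.- z ℤ.+ C) (ℤP.pos-+ k ∣ C ∣) ⟩
  ℤ.- (+ k ℤ.+ + ∣ C ∣) ℤ.+ C                  ≡⟨ regroup (+ k) (+ ∣ C ∣) C ⟩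
  ℤ.- + k ℤ.+ (C ℤ.- + ∣ C ∣)                  ≤⟨ ℤP.+-monoʳ-≤ (ℤ.- + k) (ℤP.i≤j⇒i-j≤0 (≤-abs C)) ⟩
  ℤ.- + k ℤ.+ ℤ.0ℤ                             ≡⟨ ℤP.+-identityʳ (ℤ.- + k) ⟩
  ℤ.- + k                                      ∎)
  where
  open ℤP.≤-Reasoning
  regroup : ∀ k c C → ℤ.- (k ℤ.+ c) ℤ.+ C ≡ ℤ.- k ℤ.+ (C ℤ.- c)
  regroup = solve-∀

↥-/1 : ∀ i → ↥ (i / 1) ≡ i
↥-/1 i = trans (sym (ℤP.*-identityʳ _)) (trans (cong (↥ (i / 1) ℤ.*_) (sym (gcd-zeroʳ i))) (ℚP.↥-/ i 1))

↧-/1 : ∀ i → ↧ (i / 1) ≡ + 1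
↧-/1 i = trans (sym (ℤP.*-identityʳ _)) (trans (cong (↧ (i / 1) ℤ.*_) (sym (gcd-zeroʳ i))) (ℚP.↧-/ i 1))

+-as-fraction : ∀ x y → x + y ≡ (↥ x ℤ.* ↧ y ℤ.+ ↥ y ℤ.* ↧ x) / (↧ₙ x ℕ.* ↧ₙ y)
+-as-fraction (ℚ.mkℚ _ _ _) (ℚ.mkℚ _ _ _) = refl

/1-+ : ∀ i j → (i / 1) + (j / 1) ≡ (i ℤ.+ j) / 1
/1-+ i j = trans (+-as-fraction (i / 1) (j / 1)) (ℚP./-cong numerators denominators)
  where
  numerators : ↥ (i / 1) ℤ.* ↧ (j / 1) ℤ.+ ↥ (j / 1) ℤ.* ↧ (i / 1) ≡ i ℤ.+ j
  numerators = trans (cong₂ ℤ._+_ (cong₂ ℤ._*_ (↥-/1 i) (↧-/1 j)) (cong₂ ℤ._*_ (↥-/1 j) (↧-/1 i)))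
                     (cong₂ ℤ._+_ (ℤP.*-identityʳ i) (ℤP.*-identityʳ j))
  denominators : ↧ₙ (i / 1) ℕ.* ↧ₙ (j / 1) ≡ 1
  denominators = cong₂ ℕ._*_ (ℤP.+-injective (↧-/1 i)) (ℤP.+-injective (↧-/1 j))

/1-neg : ∀ i → - (i / 1) ≡ (ℤ.- i) / 1
/1-neg i = ℚP.≃⇒≡ (ℚ.*≡* (begin
  ↥ (- (i / 1)) ℤ.* ↧ ((ℤ.- i) / 1)   ≡⟨ cong₂ ℤ._*_ (trans (ℚP.↥-neg (i / 1)) (cong ℤ.-_ (↥-/1 i))) (↧-/1 (ℤ.- i)) ⟩
  ℤ.- i ℤ.* + 1                        ≡⟨ cong₂ ℤ._*_ (↥-/1 (ℤ.- i)) (trans (ℚP.↧-neg (i / 1)) (↧-/1 i)) ⟨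
  ↥ ((ℤ.- i) / 1) ℤ.* ↧ (- (i / 1))   ∎))
  where open ≡-Reasoning

IsInt-+ : ∀ {x y} → IsInt x → IsInt y → IsInt (x + y)
IsInt-+ (i , refl) (j , refl) = i ℤ.+ j , /1-+ i j

IsInt-neg : ∀ {x} → IsInt x → IsInt (- x)
IsInt-neg (i , refl) = ℤ.- i , /1-neg i

IsInt-ι : ∀ n → IsInt (ι n)
IsInt-ι n = + n , refl

module _ where
  open +-*-Solver

  x≡[x+y]-y : ∀ x y → x ≡ (x + y) + (- y)
  x≡[x+y]-y = solve 2 (λ x y → x := (x :+ y) :+ (:- y)) refl

  x≡y+[x-y] : ∀ x y → x ≡ y + (x - y)
  x≡y+[x-y] = solve 2 (λ x y → x := y :+ (x :- y)) refl

  y≡x-[x-y] : ∀ x y → y ≡ x + (- (x - y))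
  y≡x-[x-y] = solve 2 (λ x y → y := x :+ (:- (x :- y))) refl

  neg-involutive : ∀ x → - (- x) ≡ x
  neg-involutive = solve 1 (λ x → :- (:- x) := x) refl

  [x+y]-z≡[x-z]+y : ∀ x y z → (x + y) - z ≡ (x - z) + y
  [x+y]-z≡[x-z]+y = solve 3 (λ x y z → (x :+ y) :- z := (x :- z) :+ y) refl

  x-[y+z]≡[x-y]-z : ∀ x y z → x - (y + z) ≡ (x - y) + (- z)
  x-[y+z]≡[x-y]-z = solve 3 (λ x y z → x :- (y :+ z) := (x :- y) :+ (:- z)) refl

  [x-y]+[y+z]≡x+z : ∀ x y z → (x - y) + (y + z) ≡ x + z
  [x-y]+[y+z]≡x+z = solve 3 (λ x y z → (x :- y) :+ (y :+ z) := x :+ z) refl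

  -x+[x+y]≡y : ∀ x y → (- x) + (x + y) ≡ y
  -x+[x+y]≡y = solve 2 (λ x y → (:- x) :+ (x :+ y) := y) refl

  [y-[x+1]]+[x+[1+z]]≡y+z : ∀ x y z → (y - (x + 1ℚ)) + (x + (1ℚ + z)) ≡ y + z
  [y-[x+1]]+[x+[1+z]]≡y+z = solve 3 (λ x y z → (y :- (x :+ con 1ℚ)) :+ (x :+ (con 1ℚ :+ z)) := y :+ z) refl

  [x+y]+1≡x+[1+y] : ∀ x y → (x + y) + 1ℚ ≡ x + (1ℚ + y)
  [x+y]+1≡x+[1+y] = solve 2 (λ x y → (x :+ y) :+ con 1ℚ := x :+ (con 1ℚ :+ y)) refl

  y-[x+1]≡-[x-y]-1 : ∀ x y → y - (x + 1ℚ) ≡ (- (x - y)) + (- 1ℚ)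
  y-[x+1]≡-[x-y]-1 = solve 2 (λ x y → y :- (x :+ con 1ℚ) := (:- (x :- y)) :+ (:- con 1ℚ)) refl

nonInt-+ : ∀ {x y} → ¬ IsInt x → IsInt y → ¬ IsInt (x + y)
nonInt-+ {x} {y} x∉ℤ y∈ℤ x+y∈ℤ = x∉ℤ (subst IsInt (sym (x≡[x+y]-y x y)) (IsInt-+ x+y∈ℤ (IsInt-neg y∈ℤ)))

nonInt-neg : ∀ {x} → ¬ IsInt x → ¬ IsInt (- x)
nonInt-neg {x} x∉ℤ -x∈ℤ = x∉ℤ (subst IsInt (neg-involutive x) (IsInt-neg -x∈ℤ))

nonInt⇒≢0 : ∀ {x} → ¬ IsInt x → x ≢ 0ℚ
nonInt⇒≢0 x∉ℤ refl = x∉ℤ (+ 0 , refl)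

nonInt+ι≢0 : ∀ {x} n → ¬ IsInt x → x + ι n ≢ 0ℚ
nonInt+ι≢0 n x∉ℤ = nonInt⇒≢0 (nonInt-+ x∉ℤ (IsInt-ι n))

integer-difference : ∀ {x r} → IsInt (x - r) → (∃[ n ] x ≡ r + ι n) ⊎ (∃[ n ] r ≡ x + ι (suc n))
integer-difference {x} {r} (+ n , x-r≡n) = inj₁ (n , trans (x≡y+[x-y] x r) (cong (λ d → r + d) x-r≡n))
integer-difference {x} {r} (-[1+ n ] , x-r≡-[1+n]) = inj₂ (n , (begin
  r                           ≡⟨ y≡x-[x-y] x r ⟩
  x + (- (x - r))             ≡⟨ cong (λ d → x + (- d)) (trans x-r≡-[1+n] (sym (/1-neg (+ suc n)))) ⟩
  x + (- (- ι (suc n)))       ≡⟨ cong (λ d → x + d) (neg-involutive (ι (suc n))) ⟩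
  x + ι (suc n)               ∎))
  where open ≡-Reasoning

closed-translate : ∀ (G : ℚ → Set) → (∀ {x y} → G x → IsInt y → G (x + y)) →
                   ∀ {x r} → G x → IsInt (x - r) → G r
closed-translate G G-closed {x} {r} gx x-r∈ℤ = subst G (sym (y≡x-[x-y] x r)) (G-closed gx (IsInt-neg x-r∈ℤ))

ι-suc : ∀ n → ι (suc n) ≡ 1ℚ + ι n
ι-suc n = sym (/1-+ (+ 1) (+ n))

ι-suc≢0 : ∀ n → ι (suc n) ≢ 0ℚ
ι-suc≢0 n eq with trans (sym (↥-/1 (+ suc n))) (cong ↥_ eq)
... | ()

↥-≢0 : ∀ {x} → x ≢ 0ℚ → ↥ x ≢ ℤ.0ℤ
↥-≢0 {x} x≢0 ↥x≡0 = x≢0 (ℚP.↥p≡0⇒p≡0 x ↥x≡0)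

↧-≢0 : ∀ x → ↧ x ≢ ℤ.0ℤ
↧-≢0 x ()

ℚ-*-≢0 : ∀ {x y} → x ≢ 0ℚ → y ≢ 0ℚ → x * y ≢ 0ℚ
ℚ-*-≢0 {x} {y} x≢0 y≢0 xy≡0 = ℤ-*-≢0 (↥-≢0 x≢0) (↥-≢0 y≢0)
  (trans (sym (ℚP.↥-* x y)) (annihilate (ℚP.p≡0⇒↥p≡0 (x * y) xy≡0)))
  where
  annihilate : ∀ {i g} → i ≡ ℤ.0ℤ → i ℤ.* g ≡ ℤ.0ℤ
  annihilate {g = g} refl = ℤP.*-zeroˡ g

reduced : ∀ x → Coprime ∣ ↥ x ∣ (↧ₙ x)
reduced (ℚ.mkℚ n d-1 coprime) = recompute (coprime? ∣ n ∣ (suc d-1)) coprime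

inv-inverse : ∀ {x} → x ≢ 0ℚ → x * inv x ≡ 1ℚ
inv-inverse {x} x≢0 with x ℚP.≟ 0ℚ
... | yes x≡0 = ⊥-elim (x≢0 x≡0)
... | no _    = ℚP.*-inverseʳ x {{ℚ.≢-nonZero x≢0}}

inv≢0 : ∀ {x} → x ≢ 0ℚ → inv x ≢ 0ℚ
inv≢0 {x} x≢0 inv[x]≡0 = ℚP.1≢0 (trans (sym (inv-inverse x≢0)) (trans (cong (x *_) inv[x]≡0) (ℚP.*-zeroʳ x)))

-- The p-adic valuation of natural numbers, via the factorisation n = p ^ k * u with p ∤ u.
module NatValuation {p : ℕ} (p-prime : Prime p) where

  instance
    p≢0 : NonZero p
    p≢0 = prime⇒nonZero p-prime
    p>1 : ℕ.NonTrivial p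
    p>1 = prime⇒nonTrivial p-prime

  p∤1 : ¬ p ∣ 1
  p∤1 p∣1 = ℕ.nonTrivial⇒≢1 (∣1⇒≡1 p∣1)

  record Factorisation (n : ℕ) : Set where
    constructor factorisation
    field
      exponent cofactor : ℕ
      factorises : n ≡ p ^ exponent ℕ.* cofactor
      p∤cofactor : ¬ p ∣ cofactor

  -- divide out p as long as possible; the bound n < fuel makes the recursion structural
  factoriseBelow : ∀ fuel n .{{_ : NonZero n}} → n < fuel → Factorisation n
  factoriseBelow (suc fuel) n n<fuel with p ∣? n
  ... | no p∤n = factorisation 0 n (sym (ℕP.*-identityˡ n)) p∤n
  ... | yes p∣n = factorisation (suc k) u n≡p^[1+k]*u p∤u
    where
    instance _ = ℕD.quotient≢0 p∣n
    open Factorisation (factoriseBelow fuel (quotient p∣n)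
      (ℕP.<-≤-trans (ℕD.quotient-< p∣n) (ℕ.s≤s⁻¹ n<fuel)))
      renaming (exponent to k; cofactor to u; factorises to q≡p^k*u; p∤cofactor to p∤u)
    n≡p^[1+k]*u : n ≡ p ^ suc k ℕ.* u
    n≡p^[1+k]*u = begin
      n                   ≡⟨ ℕD.m∣n⇒n≡m*quotient p∣n ⟩
      p ℕ.* quotient p∣n  ≡⟨ cong (p ℕ.*_) q≡p^k*u ⟩
      p ℕ.* (p ^ k ℕ.* u) ≡⟨ ℕP.*-assoc p (p ^ k) u ⟨
      p ^ suc k ℕ.* u     ∎
      where open ≡-Reasoning

  factorise : ∀ n .{{_ : NonZero n}} → Factorisation n
  factorise n = factoriseBelow (suc n) n ℕP.≤-refl

  p∣p^[1+k]*u : ∀ k u → p ∣ p ^ suc k ℕ.* u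
  p∣p^[1+k]*u k u = ∣-trans (m∣m*n (p ^ k)) (m∣m*n u)

  exponent-unique : ∀ k j {u w} → ¬ p ∣ u → ¬ p ∣ w → p ^ k ℕ.* u ≡ p ^ j ℕ.* w → k ≡ j
  exponent-unique zero    zero    _   _   _  = refl
  exponent-unique zero    (suc j) p∤u _   eq =
    ⊥-elim (p∤u (subst (p ∣_) (trans (sym eq) (ℕP.*-identityˡ _)) (p∣p^[1+k]*u j _)))
  exponent-unique (suc k) zero    _   p∤w eq =
    ⊥-elim (p∤w (subst (p ∣_) (trans eq (ℕP.*-identityˡ _)) (p∣p^[1+k]*u k _)))
  exponent-unique (suc k) (suc j) {u} {w} p∤u p∤w eq = cong suc (exponent-unique k j p∤u p∤w
    (ℕP.*-cancelˡ-≡ _ _ p (trans (sym (ℕP.*-assoc p _ u)) (trans eq (ℕP.*-assoc p _ w)))))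

  opaque
    -- the exponent of p in n (with the convention v 0 = 0)
    vℕ : ℕ → ℕ
    vℕ zero        = 0
    vℕ n@(suc _)   = Factorisation.exponent (factorise n)

    vℕ-unique : ∀ n k u → ¬ p ∣ u → n ≡ p ^ k ℕ.* u → vℕ n ≡ k
    vℕ-unique zero    k u p∤u eq with ℕP.m*n≡0⇒m≡0∨n≡0 (p ^ k) (sym eq)
    ... | inj₁ p^k≡0 = ⊥-elim (ℕ.≢-nonZero⁻¹ (p ^ k) {{ℕP.m^n≢0 p k}} p^k≡0)
    ... | inj₂ refl  = ⊥-elim (p∤u (p ∣0))
    vℕ-unique n@(suc _) k u p∤u eq = exponent-unique _ k p∤cofactor p∤u (trans (sym factorises) eq)
      where open Factorisation (factorise n)

    vℕ-factorises : ∀ n .{{_ : NonZero n}} → Σ ℕ λ u → n ≡ p ^ vℕ n ℕ.* u × ¬ p ∣ u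
    vℕ-factorises n@(suc _) = cofactor , factorises , p∤cofactor
      where open Factorisation (factorise n)

  vℕ-coprime : ∀ {n} → ¬ p ∣ n → vℕ n ≡ 0
  vℕ-coprime {n} p∤n = vℕ-unique n 0 n p∤n (sym (ℕP.*-identityˡ n))

  vℕ-* : ∀ m n .{{_ : NonZero m}} .{{_ : NonZero n}} → vℕ (m ℕ.* n) ≡ vℕ m ℕ.+ vℕ n
  vℕ-* m n with vℕ-factorises m | vℕ-factorises n
  ... | u , m≡ , p∤u | w , n≡ , p∤w = vℕ-unique (m ℕ.* n) _ (u ℕ.* w) p∤uw mn≡
    where
    p∤uw : ¬ p ∣ u ℕ.* w
    p∤uw p∣uw with euclidsLemma u w p-prime p∣uw
    ... | inj₁ p∣u = p∤u p∣u
    ... | inj₂ p∣w = p∤w p∣w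
    mn≡ : m ℕ.* n ≡ p ^ (vℕ m ℕ.+ vℕ n) ℕ.* (u ℕ.* w)
    mn≡ = begin
      m ℕ.* n                                       ≡⟨ cong₂ ℕ._*_ m≡ n≡ ⟩
      (p ^ vℕ m ℕ.* u) ℕ.* (p ^ vℕ n ℕ.* w)         ≡⟨ interchange (p ^ vℕ m) u (p ^ vℕ n) w ⟩
      (p ^ vℕ m ℕ.* p ^ vℕ n) ℕ.* (u ℕ.* w)         ≡⟨ cong (ℕ._* (u ℕ.* w)) (ℕP.^-distribˡ-+-* p (vℕ m) (vℕ n)) ⟨
      p ^ (vℕ m ℕ.+ vℕ n) ℕ.* (u ℕ.* w)             ∎
      where
      open ≡-Reasoning
      interchange : ∀ a b c d → (a ℕ.* b) ℕ.* (c ℕ.* d) ≡ (a ℕ.* c) ℕ.* (b ℕ.* d)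
      interchange = ℕ-Solver.solve-∀

  p^-∣ : ∀ {i j} → i ≤ j → p ^ i ∣ p ^ j
  p^-∣ {i} {j} i≤j = subst (p ^ i ∣_) p^i*p^[j-i]≡p^j (m∣m*n (p ^ (j ℕ.∸ i)))
    where
    p^i*p^[j-i]≡p^j : p ^ i ℕ.* p ^ (j ℕ.∸ i) ≡ p ^ j
    p^i*p^[j-i]≡p^j = trans (sym (ℕP.^-distribˡ-+-* p i _)) (cong (p ^_) (ℕP.m+[n∸m]≡n i≤j))

  p^vℕ∣ : ∀ n → p ^ vℕ n ∣ n
  p^vℕ∣ zero        = (p ^ vℕ 0) ∣0
  p^vℕ∣ n@(suc _) with vℕ-factorises n
  ... | u , n≡ , _ = divides u (trans n≡ (ℕP.*-comm _ u))

  p^k∣⇒k≤vℕ : ∀ k n .{{_ : NonZero n}} → p ^ k ∣ n → k ≤ vℕ n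
  p^k∣⇒k≤vℕ k n p^k∣n with k ℕP.≤? vℕ n | vℕ-factorises n
  ... | yes k≤v | _ = k≤v
  ... | no  k≰v | u , n≡ , p∤u =
    ⊥-elim (p∤u (ℕD.*-cancelˡ-∣ (p ^ vℕ n) {{ℕP.m^n≢0 p (vℕ n)}} (subst₂ _∣_ (ℕP.*-comm p _) n≡ p^[1+v]∣n)))
    where
    p^[1+v]∣n : p ^ suc (vℕ n) ∣ n
    p^[1+v]∣n = ∣-trans (p^-∣ (ℕP.≰⇒> k≰v)) p^k∣n

module Valuation {p : ℕ} (p-prime : Prime p) where
  open NatValuation p-prime

  vℤ : ℤ → ℤ
  vℤ z = + vℕ ∣ z ∣

  vℤ-* : ∀ {i j} → i ≢ ℤ.0ℤ → j ≢ ℤ.0ℤ → vℤ (i ℤ.* j) ≡ vℤ i ℤ.+ vℤ j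
  vℤ-* {i} {j} i≢0 j≢0 = begin
    + vℕ ∣ i ℤ.* j ∣              ≡⟨ cong (λ n → + vℕ n) (ℤP.abs-* i j) ⟩
    + vℕ (∣ i ∣ ℕ.* ∣ j ∣)        ≡⟨ cong +_ (vℕ-* ∣ i ∣ ∣ j ∣ {{ℤ.≢-nonZero i≢0}} {{ℤ.≢-nonZero j≢0}}) ⟩
    + (vℕ ∣ i ∣ ℕ.+ vℕ ∣ j ∣)     ≡⟨ ℤP.pos-+ (vℕ ∣ i ∣) (vℕ ∣ j ∣) ⟩
    vℤ i ℤ.+ vℤ j                 ∎
    where open ≡-Reasoning

  -- the ultrametric law on ℤ: p ^ k divides a sum of multiples of p ^ k
  vℤ-+ : ∀ e i j → i ℤ.+ j ≢ ℤ.0ℤ → e ℤ.≤ vℤ i → e ℤ.≤ vℤ j → e ℤ.≤ vℤ (i ℤ.+ j)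
  vℤ-+ -[1+ _ ] i j _ _ _ = -≤+
  vℤ-+ (+ k) i j i+j≢0 (+≤+ k≤vi) (+≤+ k≤vj) =
    +≤+ (p^k∣⇒k≤vℕ k ∣ i ℤ.+ j ∣ {{ℤ.≢-nonZero i+j≢0}} (ℤD.∣⇒∣ᵤ (ℤD.∣m∣n⇒∣m+n (p^k∣ i k≤vi) (p^k∣ j k≤vj))))
    where
    p^k∣ : ∀ z → k ≤ vℕ ∣ z ∣ → + (p ^ k) ℤD.∣ z
    p^k∣ z k≤vz = ℤD.∣ᵤ⇒∣ (∣-trans (p^-∣ k≤vz) (p^vℕ∣ ∣ z ∣))

  opaque
    v : ℚ → ℤ
    v x = vℤ (↥ x) ℤ.- vℤ (↧ x)

    v-fraction : ∀ x {g} N D → ↥ x ℤ.* g ≡ N → ↧ x ℤ.* g ≡ D → N ≢ ℤ.0ℤ → v x ≡ vℤ N ℤ.- vℤ D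
    v-fraction x {g} N D ↥x*g≡N ↧x*g≡D N≢0 = begin
      vℤ (↥ x) ℤ.- vℤ (↧ x)                                  ≡⟨ cancel (vℤ (↥ x)) (vℤ (↧ x)) (vℤ g) ⟩
      (vℤ (↥ x) ℤ.+ vℤ g) ℤ.- (vℤ (↧ x) ℤ.+ vℤ g)            ≡⟨ cong₂ ℤ._-_ (vℤ-* ↥x≢0 g≢0) (vℤ-* (↧-≢0 x) g≢0) ⟨
      vℤ (↥ x ℤ.* g) ℤ.- vℤ (↧ x ℤ.* g)                      ≡⟨ cong₂ (λ n d → vℤ n ℤ.- vℤ d) ↥x*g≡N ↧x*g≡D ⟩
      vℤ N ℤ.- vℤ D                                          ∎
      where
      open ≡-Reasoning
      cancel : ∀ a b c → a ℤ.- b ≡ (a ℤ.+ c) ℤ.- (b ℤ.+ c)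
      cancel = solve-∀
      ↥x≢0 : ↥ x ≢ ℤ.0ℤ
      ↥x≢0 ↥x≡0 = N≢0 (trans (sym ↥x*g≡N) (trans (cong (ℤ._* g) ↥x≡0) (ℤP.*-zeroˡ g)))
      g≢0 : g ≢ ℤ.0ℤ
      g≢0 g≡0 = N≢0 (trans (sym ↥x*g≡N) (trans (cong (↥ x ℤ.*_) g≡0) (ℤP.*-zeroʳ (↥ x))))

    v-* : ∀ {x y} → x ≢ 0ℚ → y ≢ 0ℚ → v (x * y) ≡ v x ℤ.+ v y
    v-* {x} {y} x≢0 y≢0 = begin
      v (x * y)                                                ≡⟨ v-fraction (x * y) _ _ (ℚP.↥-* x y) (ℚP.↧-* x y) (ℤ-*-≢0 (↥-≢0 x≢0) (↥-≢0 y≢0)) ⟩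
      vℤ (↥ x ℤ.* ↥ y) ℤ.- vℤ (↧ x ℤ.* ↧ y)                    ≡⟨ cong₂ ℤ._-_ (vℤ-* (↥-≢0 x≢0) (↥-≢0 y≢0)) (vℤ-* (↧-≢0 x) (↧-≢0 y)) ⟩
      (vℤ (↥ x) ℤ.+ vℤ (↥ y)) ℤ.- (vℤ (↧ x) ℤ.+ vℤ (↧ y))      ≡⟨ regroup (vℤ (↥ x)) (vℤ (↥ y)) (vℤ (↧ x)) (vℤ (↧ y)) ⟩
      v x ℤ.+ v y                                              ∎
      where
      open ≡-Reasoning
      regroup : ∀ a b c d → (a ℤ.+ b) ℤ.- (c ℤ.+ d) ≡ (a ℤ.- c) ℤ.+ (b ℤ.- d)
      regroup = solve-∀

    v-neg : ∀ x → v (- x) ≡ v x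
    v-neg x = trans (cong₂ (λ n d → vℤ n ℤ.- vℤ d) (ℚP.↥-neg x) (ℚP.↧-neg x))
                    (cong (λ n → + vℕ n ℤ.- vℤ (↧ x)) (ℤP.∣-i∣≡∣i∣ (↥ x)))

    v-1 : v 1ℚ ≡ ℤ.0ℤ
    v-1 = ℤP.+-inverseʳ (vℤ (+ 1))

    v-≥-denominator : ∀ x → ℤ.- vℤ (↧ x) ℤ.≤ v x
    v-≥-denominator x = subst (ℤ._≤ v x) (ℤP.+-identityˡ _) (ℤP.+-monoˡ-≤ (ℤ.- vℤ (↧ x)) (+≤+ ℕ.z≤n))

    v-denominator : ∀ x → p ∣ ↧ₙ x → v x ≡ ℤ.- vℤ (↧ x)
    v-denominator x p∣↧ = trans (cong (λ k → + k ℤ.- vℤ (↧ x)) (vℕ-coprime p∤↥)) (ℤP.+-identityˡ _)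
      where
      p∤↥ : ¬ p ∣ ∣ ↥ x ∣
      p∤↥ p∣↥ = ℕ.nonTrivial⇒≢1 (reduced x (p∣↥ , p∣↧))

  -- the ultrametric inequality: a common lower bound of v x and v y bounds v (x + y);
  -- proved by writing x, y and x + y over the common denominator ↧ x * ↧ y
  v-+ : ∀ {x y} e → x ≢ 0ℚ → y ≢ 0ℚ → x + y ≢ 0ℚ → e ℤ.≤ v x → e ℤ.≤ v y → e ℤ.≤ v (x + y)
  v-+ {x} {y} e x≢0 y≢0 x+y≢0 e≤vx e≤vy =
    subst (e ℤ.≤_) (sym v[x+y]) (≤-shiftˡ {d = vℤ D} (vℤ-+ _ X Y X+Y≢0 (≤-shiftʳ {d = vℤ D} (subst (e ℤ.≤_) vx e≤vx))
                                                           (≤-shiftʳ {d = vℤ D} (subst (e ℤ.≤_) vy e≤vy))))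
    where
    X = ↥ x ℤ.* ↧ y
    Y = ↥ y ℤ.* ↧ x
    D = ↧ x ℤ.* ↧ y
    vx : v x ≡ vℤ X ℤ.- vℤ D
    vx = v-fraction x X D refl refl (ℤ-*-≢0 (↥-≢0 x≢0) (↧-≢0 y))
    vy : v y ≡ vℤ Y ℤ.- vℤ D
    vy = v-fraction y Y D refl (ℤP.*-comm (↧ y) (↧ x)) (ℤ-*-≢0 (↥-≢0 y≢0) (↧-≢0 x))
    X+Y≢0 : X ℤ.+ Y ≢ ℤ.0ℤ
    X+Y≢0 X+Y≡0 with ℤP.i*j≡0⇒i≡0∨j≡0 (↥ (x + y)) (trans (ℚP.↥-+ x y) X+Y≡0)
    ... | inj₁ ↥≡0  = ↥-≢0 x+y≢0 ↥≡0
    ... | inj₂ nf≡0 = ℤ-*-≢0 (↧-≢0 x) (↧-≢0 y)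
                        (trans (sym (ℚP.↧-+ x y)) (trans (cong (↧ (x + y) ℤ.*_) nf≡0) (ℤP.*-zeroʳ (↧ (x + y)))))
    v[x+y] : v (x + y) ≡ vℤ (X ℤ.+ Y) ℤ.- vℤ D
    v[x+y] = v-fraction (x + y) (X ℤ.+ Y) D (ℚP.↥-+ x y) (ℚP.↧-+ x y) X+Y≢0

  v-integer : ∀ {i} → i ≢ ℤ.0ℤ → ℤ.0ℤ ℤ.≤ v (i / 1)
  v-integer {i} i≢0 = subst (ℤ.0ℤ ℤ.≤_) (sym v[i/1]) (+≤+ ℕ.z≤n)
    where
    v[i/1] : v (i / 1) ≡ vℤ i
    v[i/1] = begin
      v (i / 1)                     ≡⟨ v-fraction (i / 1) i (+ 1) (ℚP.↥-/ i 1) (ℚP.↧-/ i 1) i≢0 ⟩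
      vℤ i ℤ.- + vℕ 1               ≡⟨ cong (λ k → vℤ i ℤ.- + k) (vℕ-coprime p∤1) ⟩
      vℤ i ℤ.+ ℤ.0ℤ                 ≡⟨ ℤP.+-identityʳ (vℤ i) ⟩
      vℤ i                          ∎
      where open ≡-Reasoning

  v-inv : ∀ {x} → x ≢ 0ℚ → v (inv x) ≡ ℤ.- v x
  v-inv {x} x≢0 = begin
    v (inv x)                              ≡⟨ regroup (v x) (v (inv x)) ⟩
    ℤ.- v x ℤ.+ (v x ℤ.+ v (inv x))        ≡⟨ cong (λ z → ℤ.- v x ℤ.+ z) (v-* x≢0 (inv≢0 x≢0)) ⟨
    ℤ.- v x ℤ.+ v (x * inv x)              ≡⟨ cong (λ y → ℤ.- v x ℤ.+ v y) (inv-inverse x≢0) ⟩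
    ℤ.- v x ℤ.+ v 1ℚ                       ≡⟨ cong (λ z → ℤ.- v x ℤ.+ z) v-1 ⟩
    ℤ.- v x ℤ.+ ℤ.0ℤ                       ≡⟨ ℤP.+-identityʳ (ℤ.- v x) ⟩
    ℤ.- v x                                ∎
    where
    open ≡-Reasoning
    regroup : ∀ a b → b ≡ ℤ.- a ℤ.+ (a ℤ.+ b)
    regroup = solve-∀

  padicallyUnbounded⇔ : ∀ A → PAdicallyUnbounded p A ⇔ Unbounded (λ m → v (A m))
  padicallyUnbounded⇔ A = mk⇔ to from
    where
    to : PAdicallyUnbounded p A → Unbounded (λ m → v (A m))
    to unbounded k with unbounded (suc k)
    ... | m , p^[1+k]∣↧ = m , (begin
      v (A m)                 ≡⟨ v-denominator (A m) (∣-trans (m∣m*n (p ^ k)) p^[1+k]∣↧) ⟩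
      ℤ.- vℤ (↧ (A m))        ≤⟨ ℤP.neg-mono-≤ (+≤+ (p^k∣⇒k≤vℕ (suc k) (↧ₙ (A m)) p^[1+k]∣↧)) ⟩
      ℤ.- + suc k             ≤⟨ ℤP.neg-mono-≤ (+≤+ (ℕP.n≤1+n k)) ⟩
      ℤ.- + k                 ∎)
      where open ℤP.≤-Reasoning
    from : Unbounded (λ m → v (A m)) → PAdicallyUnbounded p A
    from unbounded k with unbounded k
    ... | m , v≤-k = m , ∣-trans (p^-∣ k≤v↧) (p^vℕ∣ (↧ₙ (A m)))
      where
      k≤v↧ : k ≤ vℕ (↧ₙ (A m))
      k≤v↧ = ℤP.drop‿+≤+ (ℤP.neg-cancel-≤ (ℤP.≤-trans (v-≥-denominator (A m)) v≤-k))

  v-translate : ∀ {x} n → x ≢ 0ℚ → x + ι n ≢ 0ℚ → v x ℤ.⊓ ℤ.0ℤ ℤ.≤ v (x + ι n)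
  v-translate {x} zero    _   _     = subst (λ y → v x ℤ.⊓ ℤ.0ℤ ℤ.≤ v y) (sym (ℚP.+-identityʳ x)) (ℤP.i⊓j≤i _ _)
  v-translate {x} (suc n) x≢0 x+n≢0 =
    v-+ _ x≢0 (ι-suc≢0 n) x+n≢0 (ℤP.i⊓j≤i _ _) (ℤP.≤-trans (ℤP.i⊓j≤j _ _) (v-integer {+ suc n} (λ ())))

  v-dominant : ∀ {x y z} → x + y ≡ z → x ≢ 0ℚ → y ≢ 0ℚ → z ≢ 0ℚ → v x ℤ.< v y → v z ℤ.≤ v x
  v-dominant {x} {y} {z} x+y≡z x≢0 y≢0 z≢0 vx<vy = by-cases (ℤP.≤-total (v z) (v y))
    where
    -- x = z + (- y), so the ultrametric inequality bounds v x from below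
    common-bound : ∀ e → e ℤ.≤ v z → e ℤ.≤ v y → e ℤ.≤ v x
    common-bound e e≤vz e≤vy = subst (λ w → e ℤ.≤ v w) z-y≡x
      (v-+ e z≢0 -y≢0 (subst (_≢ 0ℚ) (sym z-y≡x) x≢0) e≤vz (subst (e ℤ.≤_) (sym (v-neg y)) e≤vy))
      where
      z-y≡x : z + (- y) ≡ x
      z-y≡x = trans (cong (λ w → w + (- y)) (sym x+y≡z)) (sym (x≡[x+y]-y x y))
      -y≢0 : - y ≢ 0ℚ
      -y≢0 -y≡0 = y≢0 (trans (sym (neg-involutive y)) (cong -_ -y≡0))
    by-cases : v z ℤ.≤ v y ⊎ v y ℤ.≤ v z → v z ℤ.≤ v x
    by-cases (inj₁ vz≤vy) = common-bound (v z) ℤP.≤-refl vz≤vy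
    by-cases (inj₂ vy≤vz) = ⊥-elim (ℤP.≤⇒≯ (common-bound (v y) vy≤vz ℤP.≤-refl) vx<vy)

poch≢0 : ∀ {x} → ¬ IsInt x → ∀ m → poch x m ≢ 0ℚ
poch≢0 x∉ℤ zero    = λ ()
poch≢0 x∉ℤ (suc m) = ℚ-*-≢0 (poch≢0 x∉ℤ m) (nonInt+ι≢0 m x∉ℤ)

fact≢0 : ∀ m → fact m ≢ 0ℚ
fact≢0 zero    = λ ()
fact≢0 (suc m) = ℚ-*-≢0 (fact≢0 m) (ι-suc≢0 m)

poch-shift : ∀ x m → poch (x + 1ℚ) m * x ≡ poch x m * (x + ι m)
poch-shift x zero    = cong (1ℚ *_) (sym (ℚP.+-identityʳ x))
poch-shift x (suc m) = begin
  poch (x + 1ℚ) m * ((x + 1ℚ) + ι m) * x     ≡⟨ swap (poch (x + 1ℚ) m) ((x + 1ℚ) + ι m) x ⟩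
  poch (x + 1ℚ) m * x * ((x + 1ℚ) + ι m)     ≡⟨ cong₂ _*_ (poch-shift x m) x+1+m≡x+[1+m] ⟩
  poch x m * (x + ι m) * (x + ι (suc m))     ∎
  where
  open ≡-Reasoning
  open +-*-Solver
  swap : ∀ a b c → a * b * c ≡ a * c * b
  swap = solve 3 (λ a b c → a :* b :* c := a :* c :* b) refl
  x+1+m≡x+[1+m] : (x + 1ℚ) + ι m ≡ x + ι (suc m)
  x+1+m≡x+[1+m] = trans (ℚP.+-assoc x 1ℚ (ι m)) (cong (λ d → x + d) (sym (ι-suc m)))

module CoefficientValuations {p : ℕ} (p-prime : Prime p) where
  open Valuation p-prime

  w : ℚ → ℚ → ℚ → ℕ → ℤ
  w a b c m = v (coeff2F1 a b c m)

  w-decomposition : ∀ {a b c} → ¬ IsInt a → ¬ IsInt b → ¬ IsInt c → ∀ m →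
    w a b c m ≡ (v (poch a m) ℤ.+ v (poch b m)) ℤ.- (v (poch c m) ℤ.+ v (fact m))
  w-decomposition {a} {b} {c} a∉ℤ b∉ℤ c∉ℤ m = begin
    v (poch a m * poch b m * inv (poch c m * fact m))
      ≡⟨ v-* (ℚ-*-≢0 (poch≢0 a∉ℤ m) (poch≢0 b∉ℤ m)) (inv≢0 denominator≢0) ⟩
    v (poch a m * poch b m) ℤ.+ v (inv (poch c m * fact m))
      ≡⟨ cong₂ ℤ._+_ (v-* (poch≢0 a∉ℤ m) (poch≢0 b∉ℤ m)) (v-inv denominator≢0) ⟩
    (v (poch a m) ℤ.+ v (poch b m)) ℤ.- v (poch c m * fact m)
      ≡⟨ cong (λ d → (v (poch a m) ℤ.+ v (poch b m)) ℤ.- d) (v-* (poch≢0 c∉ℤ m) (fact≢0 m)) ⟩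
    (v (poch a m) ℤ.+ v (poch b m)) ℤ.- (v (poch c m) ℤ.+ v (fact m))   ∎
    where
    open ≡-Reasoning
    denominator≢0 : poch c m * fact m ≢ 0ℚ
    denominator≢0 = ℚ-*-≢0 (poch≢0 c∉ℤ m) (fact≢0 m)

  v-poch-suc : ∀ {x} → ¬ IsInt x → ∀ m → v (poch x (suc m)) ≡ v (poch x m) ℤ.+ v (x + ι m)
  v-poch-suc x∉ℤ m = v-* (poch≢0 x∉ℤ m) (nonInt+ι≢0 m x∉ℤ)

  v-fact-suc : ∀ m → v (fact (suc m)) ≡ v (fact m) ℤ.+ v (ι (suc m))
  v-fact-suc m = v-* (fact≢0 m) (ι-suc≢0 m)

  v-poch-shift : ∀ {x} → ¬ IsInt x → ∀ m → v (poch (x + 1ℚ) m) ≡ v (poch x m) ℤ.+ (v (x + ι m) ℤ.- v x)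
  v-poch-shift {x} x∉ℤ m = a+d≡b+c⇒a≡b+[c-d] (v (poch (x + 1ℚ) m)) (v x) (v (poch x m)) (v (x + ι m)) (begin
    v (poch (x + 1ℚ) m) ℤ.+ v x      ≡⟨ v-* (poch≢0 x+1∉ℤ m) (nonInt⇒≢0 x∉ℤ) ⟨
    v (poch (x + 1ℚ) m * x)          ≡⟨ cong v (poch-shift x m) ⟩
    v (poch x m * (x + ι m))         ≡⟨ v-* (poch≢0 x∉ℤ m) (nonInt+ι≢0 m x∉ℤ) ⟩
    v (poch x m) ℤ.+ v (x + ι m)     ∎)
    where
    open ≡-Reasoning
    x+1∉ℤ : ¬ IsInt (x + 1ℚ)
    x+1∉ℤ = nonInt-+ x∉ℤ (IsInt-ι 1)

  module _ {a b c : ℚ} (a∉ℤ : ¬ IsInt a) (b∉ℤ : ¬ IsInt b) (c∉ℤ : ¬ IsInt c) where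
    private
      A B C F : ℕ → ℤ
      A m = v (poch a m)
      B m = v (poch b m)
      C m = v (poch c m)
      F m = v (fact m)
      open ≡-Reasoning

    w-shift-a : ∀ m → w (a + 1ℚ) b c m ≡ w a b c m ℤ.+ (v (a + ι m) ℤ.- v a)
    w-shift-a m = begin
      w (a + 1ℚ) b c m                                             ≡⟨ w-decomposition (nonInt-+ a∉ℤ (IsInt-ι 1)) b∉ℤ c∉ℤ m ⟩
      (v (poch (a + 1ℚ) m) ℤ.+ B m) ℤ.- (C m ℤ.+ F m)              ≡⟨ cong (λ z → (z ℤ.+ B m) ℤ.- (C m ℤ.+ F m)) (v-poch-shift a∉ℤ m) ⟩
      ((A m ℤ.+ (v (a + ι m) ℤ.- v a)) ℤ.+ B m) ℤ.- (C m ℤ.+ F m)  ≡⟨ regroup (A m) (B m) (C m) (F m) (v (a + ι m) ℤ.- v a) ⟩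
      ((A m ℤ.+ B m) ℤ.- (C m ℤ.+ F m)) ℤ.+ (v (a + ι m) ℤ.- v a)  ≡⟨ cong (ℤ._+ (v (a + ι m) ℤ.- v a)) (w-decomposition a∉ℤ b∉ℤ c∉ℤ m) ⟨
      w a b c m ℤ.+ (v (a + ι m) ℤ.- v a)                          ∎
      where
      regroup : ∀ a b c f d → ((a ℤ.+ d) ℤ.+ b) ℤ.- (c ℤ.+ f) ≡ ((a ℤ.+ b) ℤ.- (c ℤ.+ f)) ℤ.+ d
      regroup = solve-∀

    w-shift-c : ∀ m → w a b (c + 1ℚ) m ≡ w a b c m ℤ.+ (v c ℤ.- v (c + ι m))
    w-shift-c m = begin
      w a b (c + 1ℚ) m                                             ≡⟨ w-decomposition a∉ℤ b∉ℤ (nonInt-+ c∉ℤ (IsInt-ι 1)) m ⟩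
      (A m ℤ.+ B m) ℤ.- (v (poch (c + 1ℚ) m) ℤ.+ F m)              ≡⟨ cong (λ z → (A m ℤ.+ B m) ℤ.- (z ℤ.+ F m)) (v-poch-shift c∉ℤ m) ⟩
      (A m ℤ.+ B m) ℤ.- ((C m ℤ.+ (v (c + ι m) ℤ.- v c)) ℤ.+ F m)  ≡⟨ regroup (A m) (B m) (C m) (F m) (v (c + ι m)) (v c) ⟩
      ((A m ℤ.+ B m) ℤ.- (C m ℤ.+ F m)) ℤ.+ (v c ℤ.- v (c + ι m))  ≡⟨ cong (ℤ._+ (v c ℤ.- v (c + ι m))) (w-decomposition a∉ℤ b∉ℤ c∉ℤ m) ⟨
      w a b c m ℤ.+ (v c ℤ.- v (c + ι m))                          ∎
      where
      regroup : ∀ a b c f t s → (a ℤ.+ b) ℤ.- ((c ℤ.+ (t ℤ.- s)) ℤ.+ f) ≡ ((a ℤ.+ b) ℤ.- (c ℤ.+ f)) ℤ.+ (s ℤ.- t)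
      regroup = solve-∀

    w-unshift-a : ∀ m → w a b c m ≡ w (a + 1ℚ) b c m ℤ.+ (v a ℤ.- v (a + ι m))
    w-unshift-a m = ≡+[s-t]⇒≡+[t-s] (w (a + 1ℚ) b c m) (w a b c m) (v (a + ι m)) (v a) (w-shift-a m)

    w-unshift-c : ∀ m → w a b c m ≡ w a b (c + 1ℚ) m ℤ.+ (v (c + ι m) ℤ.- v c)
    w-unshift-c m = ≡+[s-t]⇒≡+[t-s] (w a b (c + 1ℚ) m) (w a b c m) (v c) (v (c + ι m)) (w-shift-c m)

    w-suc : ∀ m → w a b c (suc m) ≡ w a b c m ℤ.+ ((v (a + ι m) ℤ.+ v (b + ι m)) ℤ.- (v (c + ι m) ℤ.+ v (ι (suc m))))
    w-suc m = begin
      w a b c (suc m)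
        ≡⟨ w-decomposition a∉ℤ b∉ℤ c∉ℤ (suc m) ⟩
      (A (suc m) ℤ.+ B (suc m)) ℤ.- (C (suc m) ℤ.+ F (suc m))
        ≡⟨ cong₂ ℤ._-_ (cong₂ ℤ._+_ (v-poch-suc a∉ℤ m) (v-poch-suc b∉ℤ m)) (cong₂ ℤ._+_ (v-poch-suc c∉ℤ m) (v-fact-suc m)) ⟩
      ((A m ℤ.+ v (a + ι m)) ℤ.+ (B m ℤ.+ v (b + ι m))) ℤ.- ((C m ℤ.+ v (c + ι m)) ℤ.+ (F m ℤ.+ v (ι (suc m))))
        ≡⟨ regroup (A m) (B m) (C m) (F m) (v (a + ι m)) (v (b + ι m)) (v (c + ι m)) (v (ι (suc m))) ⟩
      ((A m ℤ.+ B m) ℤ.- (C m ℤ.+ F m)) ℤ.+ ((v (a + ι m) ℤ.+ v (b + ι m)) ℤ.- (v (c + ι m) ℤ.+ v (ι (suc m))))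
        ≡⟨ cong (ℤ._+ ((v (a + ι m) ℤ.+ v (b + ι m)) ℤ.- (v (c + ι m) ℤ.+ v (ι (suc m))))) (w-decomposition a∉ℤ b∉ℤ c∉ℤ m) ⟨
      w a b c m ℤ.+ ((v (a + ι m) ℤ.+ v (b + ι m)) ℤ.- (v (c + ι m) ℤ.+ v (ι (suc m))))
        ∎
      where
      regroup : ∀ a b c f ta tb tc tf →
        ((a ℤ.+ ta) ℤ.+ (b ℤ.+ tb)) ℤ.- ((c ℤ.+ tc) ℤ.+ (f ℤ.+ tf)) ≡ ((a ℤ.+ b) ℤ.- (c ℤ.+ f)) ℤ.+ ((ta ℤ.+ tb) ℤ.- (tc ℤ.+ tf))
      regroup = solve-∀

    w-shift-a-suc : ∀ m → w (a + 1ℚ) b c m ≡ w a b c (suc m) ℤ.+ ((v (c + ι m) ℤ.+ v (ι (suc m))) ℤ.- (v a ℤ.+ v (b + ι m)))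
    w-shift-a-suc m = begin
      w (a + 1ℚ) b c m                           ≡⟨ w-shift-a m ⟩
      w a b c m ℤ.+ (ta ℤ.- v a)                 ≡⟨ regroup (w a b c m) ta tb tc ti (v a) ⟩
      (w a b c m ℤ.+ ((ta ℤ.+ tb) ℤ.- (tc ℤ.+ ti))) ℤ.+ ((tc ℤ.+ ti) ℤ.- (v a ℤ.+ tb))
                                                 ≡⟨ cong (ℤ._+ ((tc ℤ.+ ti) ℤ.- (v a ℤ.+ tb))) (w-suc m) ⟨
      w a b c (suc m) ℤ.+ ((tc ℤ.+ ti) ℤ.- (v a ℤ.+ tb)) ∎
      where
      ta = v (a + ι m)
      tb = v (b + ι m)
      tc = v (c + ι m)
      ti = v (ι (suc m))
      regroup : ∀ W ta tb tc ti va →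
        W ℤ.+ (ta ℤ.- va) ≡ (W ℤ.+ ((ta ℤ.+ tb) ℤ.- (tc ℤ.+ ti))) ℤ.+ ((tc ℤ.+ ti) ℤ.- (va ℤ.+ tb))
      regroup = solve-∀

    w-suc-shift-c : ∀ m → w a b c (suc m) ≡ w a b (c + 1ℚ) m ℤ.+ ((v (a + ι m) ℤ.+ v (b + ι m)) ℤ.- (v c ℤ.+ v (ι (suc m))))
    w-suc-shift-c m = begin
      w a b c (suc m)                                              ≡⟨ w-suc m ⟩
      w a b c m ℤ.+ ((ta ℤ.+ tb) ℤ.- (tc ℤ.+ ti))                  ≡⟨ regroup (w a b c m) ta tb tc ti (v c) ⟩
      (w a b c m ℤ.+ (v c ℤ.- tc)) ℤ.+ ((ta ℤ.+ tb) ℤ.- (v c ℤ.+ ti))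
                                                                   ≡⟨ cong (ℤ._+ ((ta ℤ.+ tb) ℤ.- (v c ℤ.+ ti))) (w-shift-c m) ⟨
      w a b (c + 1ℚ) m ℤ.+ ((ta ℤ.+ tb) ℤ.- (v c ℤ.+ ti))          ∎
      where
      ta = v (a + ι m)
      tb = v (b + ι m)
      tc = v (c + ι m)
      ti = v (ι (suc m))
      regroup : ∀ W ta tb tc ti vc →
        W ℤ.+ ((ta ℤ.+ tb) ℤ.- (tc ℤ.+ ti)) ≡ (W ℤ.+ (vc ℤ.- tc)) ℤ.+ ((ta ℤ.+ tb) ℤ.- (vc ℤ.+ ti))
      regroup = solve-∀

record Admissible (a b c : ℚ) : Set where
  field
    a∉ℤ   : ¬ IsInt a
    b∉ℤ   : ¬ IsInt b
    c∉ℤ   : ¬ IsInt c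
    a-c∉ℤ : ¬ IsInt (a - c)
    b-c∉ℤ : ¬ IsInt (b - c)

admissible-swap : ∀ {a b c} → Admissible a b c → Admissible b a c
admissible-swap adm = record { a∉ℤ = b∉ℤ ; b∉ℤ = a∉ℤ ; c∉ℤ = c∉ℤ ; a-c∉ℤ = b-c∉ℤ ; b-c∉ℤ = a-c∉ℤ }
  where open Admissible adm

admissible-+a : ∀ {a b c y} → Admissible a b c → IsInt y → Admissible (a + y) b c
admissible-+a {a} {b} {c} {y} adm y∈ℤ = record
  { a∉ℤ = nonInt-+ a∉ℤ y∈ℤ ; b∉ℤ = b∉ℤ ; c∉ℤ = c∉ℤ
  ; a-c∉ℤ = subst (λ z → ¬ IsInt z) (sym ([x+y]-z≡[x-z]+y a y c)) (nonInt-+ a-c∉ℤ y∈ℤ) ; b-c∉ℤ = b-c∉ℤ }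
  where open Admissible adm

admissible-+c : ∀ {a b c y} → Admissible a b c → IsInt y → Admissible a b (c + y)
admissible-+c {a} {b} {c} {y} adm y∈ℤ = record
  { a∉ℤ = a∉ℤ ; b∉ℤ = b∉ℤ ; c∉ℤ = nonInt-+ c∉ℤ y∈ℤ
  ; a-c∉ℤ = subst (λ z → ¬ IsInt z) (sym (x-[y+z]≡[x-y]-z a c y)) (nonInt-+ a-c∉ℤ (IsInt-neg y∈ℤ))
  ; b-c∉ℤ = subst (λ z → ¬ IsInt z) (sym (x-[y+z]≡[x-y]-z b c y)) (nonInt-+ b-c∉ℤ (IsInt-neg y∈ℤ)) }
  where open Admissible adm

admissible-retarget-a : ∀ {a b c r} → Admissible a b c → IsInt (a - r) → Admissible r b c
admissible-retarget-a {b = b} {c} = closed-translate (λ x → Admissible x b c) admissible-+a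

admissible-retarget-b : ∀ {a b c s} → Admissible a b c → IsInt (b - s) → Admissible a s c
admissible-retarget-b adm b-s∈ℤ = admissible-swap (admissible-retarget-a (admissible-swap adm) b-s∈ℤ)

module UnitSteps {p : ℕ} (p-prime : Prime p) {a b c : ℚ} (adm : Admissible a b c) where
  open Valuation p-prime
  open CoefficientValuations p-prime
  open Admissible adm
  open ℤP using (i≤i⊔j; i≤j⊔i)

  open ℤP.≤-Reasoning

  -- passing from a + 1 to a costs at most v a - min (v a) 0, since v (a + m) ≥ min (v a) 0
  a+1⇒a : Unbounded (w (a + 1ℚ) b c) → Unbounded (w a b c)
  a+1⇒a = Unbounded-transfer {w (a + 1ℚ) b c} {w a b c} (v a ℤ.- (v a ℤ.⊓ ℤ.0ℤ)) λ m → m , (begin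
    w a b c m                                          ≡⟨ w-unshift-a a∉ℤ b∉ℤ c∉ℤ m ⟩
    w (a + 1ℚ) b c m ℤ.+ (v a ℤ.- v (a + ι m))         ≤⟨ ℤP.+-monoʳ-≤ (w (a + 1ℚ) b c m) (ℤP.+-monoʳ-≤ (v a) (ℤP.neg-mono-≤
                                                            (v-translate m (nonInt⇒≢0 a∉ℤ) (nonInt+ι≢0 m a∉ℤ)))) ⟩
    w (a + 1ℚ) b c m ℤ.+ (v a ℤ.- (v a ℤ.⊓ ℤ.0ℤ))      ∎)

  c⇒c+1 : Unbounded (w a b c) → Unbounded (w a b (c + 1ℚ))
  c⇒c+1 = Unbounded-transfer {w a b c} {w a b (c + 1ℚ)} (v c ℤ.- (v c ℤ.⊓ ℤ.0ℤ)) λ m → m , (begin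
    w a b (c + 1ℚ) m                                   ≡⟨ w-shift-c a∉ℤ b∉ℤ c∉ℤ m ⟩
    w a b c m ℤ.+ (v c ℤ.- v (c + ι m))                ≤⟨ ℤP.+-monoʳ-≤ (w a b c m) (ℤP.+-monoʳ-≤ (v c) (ℤP.neg-mono-≤
                                                            (v-translate m (nonInt⇒≢0 c∉ℤ) (nonInt+ι≢0 m c∉ℤ)))) ⟩
    w a b c m ℤ.+ (v c ℤ.- (v c ℤ.⊓ ℤ.0ℤ))             ∎)

  -- passing from a to a + 1: either v (a + m) is at most L, or the ultrametric inequality pins
  -- down v m and v (c + m - 1), and the coefficient of index m of 2F1(a, b; c) is matched by
  -- that of index m - 1 of 2F1(a + 1, b; c)
  a⇒a+1 : Unbounded (w a b c) → Unbounded (w (a + 1ℚ) b c)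
  a⇒a+1 = Unbounded-transfer {w a b c} {w (a + 1ℚ) b c} (C₁ ℤ.⊔ C₂) matched
    where
    d = c - (a + 1ℚ)
    L = v a ℤ.⊔ v d
    C₁ = L ℤ.- v a
    C₂ = (v d ℤ.+ v a) ℤ.- (v a ℤ.+ (v b ℤ.⊓ ℤ.0ℤ))
    d≢0 : d ≢ 0ℚ
    d≢0 = nonInt⇒≢0 (subst (λ z → ¬ IsInt z) (sym (y-[x+1]≡-[x-y]-1 a c))
                             (nonInt-+ (nonInt-neg a-c∉ℤ) (IsInt-neg (IsInt-ι 1))))
    matched : ∀ m → ∃[ m′ ] w (a + 1ℚ) b c m′ ℤ.≤ w a b c m ℤ.+ (C₁ ℤ.⊔ C₂)
    matched m with v (a + ι m) ℤP.≤? L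
    ... | yes small = m , (begin
      w (a + 1ℚ) b c m                       ≡⟨ w-shift-a a∉ℤ b∉ℤ c∉ℤ m ⟩
      w a b c m ℤ.+ (v (a + ι m) ℤ.- v a)    ≤⟨ ℤP.+-monoʳ-≤ (w a b c m) (ℤP.≤-trans (ℤP.+-monoˡ-≤ (ℤ.- v a) small) (i≤i⊔j C₁ C₂)) ⟩
      w a b c m ℤ.+ (C₁ ℤ.⊔ C₂)              ∎)
    matched zero    | no large = ⊥-elim (large (subst (ℤ._≤ L) (cong v (sym (ℚP.+-identityʳ a))) (i≤i⊔j (v a) (v d))))
    matched (suc n) | no large = n , (begin
      w (a + 1ℚ) b c n
        ≡⟨ w-shift-a-suc a∉ℤ b∉ℤ c∉ℤ n ⟩
      w a b c (suc n) ℤ.+ ((v (c + ι n) ℤ.+ v (ι (suc n))) ℤ.- (v a ℤ.+ v (b + ι n)))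
        ≤⟨ ℤP.+-monoʳ-≤ (w a b c (suc n)) (ℤP.≤-trans
             (ℤP.+-mono-≤ (ℤP.+-mono-≤ v[c+n]≤vd v[1+n]≤va)
                          (ℤP.neg-mono-≤ (ℤP.+-monoʳ-≤ (v a) (v-translate n (nonInt⇒≢0 b∉ℤ) (nonInt+ι≢0 n b∉ℤ)))))
             (i≤j⊔i C₁ C₂)) ⟩
      w a b c (suc n) ℤ.+ (C₁ ℤ.⊔ C₂)
        ∎)
      where
      L<v[a+1+n] : L ℤ.< v (a + ι (suc n))
      L<v[a+1+n] = ℤP.≰⇒> large
      a+1+n≢0 : a + ι (suc n) ≢ 0ℚ
      a+1+n≢0 = nonInt+ι≢0 (suc n) a∉ℤ
      -- c + n = d + (a + n + 1), and v d ≤ L < v (a + n + 1)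
      v[c+n]≤vd : v (c + ι n) ℤ.≤ v d
      v[c+n]≤vd = v-dominant (trans (cong (λ t → d + (a + t)) (ι-suc n)) ([y-[x+1]]+[x+[1+z]]≡y+z a c (ι n)))
                    d≢0 a+1+n≢0 (nonInt+ι≢0 n c∉ℤ) (ℤP.≤-<-trans (i≤j⊔i (v a) (v d)) L<v[a+1+n])
      -- n + 1 = (- a) + (a + n + 1), and v (- a) = v a ≤ L < v (a + n + 1)
      v[1+n]≤va : v (ι (suc n)) ℤ.≤ v a
      v[1+n]≤va = subst (v (ι (suc n)) ℤ.≤_) (v-neg a)
                    (v-dominant (-x+[x+y]≡y a (ι (suc n))) (nonInt⇒≢0 (nonInt-neg a∉ℤ)) a+1+n≢0 (ι-suc≢0 n)
                      (subst (ℤ._< v (a + ι (suc n))) (sym (v-neg a)) (ℤP.≤-<-trans (i≤i⊔j (v a) (v d)) L<v[a+1+n])))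

  -- passing from c + 1 to c: either v (c + m) is at most L, or v (a + m) ≤ v (a - c) and
  -- v (b + m) ≤ v (b - c), and the coefficient of index m of 2F1(a, b; c + 1) is matched by
  -- that of index m + 1 of 2F1(a, b; c)
  c+1⇒c : Unbounded (w a b (c + 1ℚ)) → Unbounded (w a b c)
  c+1⇒c = Unbounded-transfer {w a b (c + 1ℚ)} {w a b c} (C₁ ℤ.⊔ C₂) matched
    where
    L = v (a - c) ℤ.⊔ v (b - c)
    C₁ = L ℤ.- v c
    C₂ = (v (a - c) ℤ.+ v (b - c)) ℤ.- (v c ℤ.+ ℤ.0ℤ)
    matched : ∀ m → ∃[ m′ ] w a b c m′ ℤ.≤ w a b (c + 1ℚ) m ℤ.+ (C₁ ℤ.⊔ C₂)
    matched m with v (c + ι m) ℤP.≤? L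
    ... | yes small = m , (begin
      w a b c m                                    ≡⟨ w-unshift-c a∉ℤ b∉ℤ c∉ℤ m ⟩
      w a b (c + 1ℚ) m ℤ.+ (v (c + ι m) ℤ.- v c)   ≤⟨ ℤP.+-monoʳ-≤ (w a b (c + 1ℚ) m)
                                                         (ℤP.≤-trans (ℤP.+-monoˡ-≤ (ℤ.- v c) small) (i≤i⊔j C₁ C₂)) ⟩
      w a b (c + 1ℚ) m ℤ.+ (C₁ ℤ.⊔ C₂)             ∎)
    ... | no large = suc m , (begin
      w a b c (suc m)
        ≡⟨ w-suc-shift-c a∉ℤ b∉ℤ c∉ℤ m ⟩
      w a b (c + 1ℚ) m ℤ.+ ((v (a + ι m) ℤ.+ v (b + ι m)) ℤ.- (v c ℤ.+ v (ι (suc m))))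
        ≤⟨ ℤP.+-monoʳ-≤ (w a b (c + 1ℚ) m) (ℤP.≤-trans
             (ℤP.+-mono-≤ (ℤP.+-mono-≤ (v[x+m]≤v[x-c] a∉ℤ a-c∉ℤ (i≤i⊔j (v (a - c)) (v (b - c))))
                                       (v[x+m]≤v[x-c] b∉ℤ b-c∉ℤ (i≤j⊔i (v (a - c)) (v (b - c)))))
                          (ℤP.neg-mono-≤ (ℤP.+-monoʳ-≤ (v c) (v-integer {+ suc m} (λ ())))))
             (i≤j⊔i C₁ C₂)) ⟩
      w a b (c + 1ℚ) m ℤ.+ (C₁ ℤ.⊔ C₂)
        ∎)
      where
      -- x + m = (x - c) + (c + m), and v (x - c) ≤ L < v (c + m)
      v[x+m]≤v[x-c] : ∀ {x} → ¬ IsInt x → ¬ IsInt (x - c) → v (x - c) ℤ.≤ L → v (x + ι m) ℤ.≤ v (x - c)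
      v[x+m]≤v[x-c] {x} x∉ℤ x-c∉ℤ v[x-c]≤L = v-dominant ([x-y]+[y+z]≡x+z x c (ι m)) (nonInt⇒≢0 x-c∉ℤ)
        (nonInt+ι≢0 m c∉ℤ) (nonInt+ι≢0 m x∉ℤ) (ℤP.≤-<-trans v[x-c]≤L (ℤP.≰⇒> large))

  a⇔a+1 : Unbounded (w a b c) ⇔ Unbounded (w (a + 1ℚ) b c)
  a⇔a+1 = mk⇔ a⇒a+1 a+1⇒a

  c⇔c+1 : Unbounded (w a b c) ⇔ Unbounded (w a b (c + 1ℚ))
  c⇔c+1 = mk⇔ c⇒c+1 c+1⇒c

module IntegerTranslation (G F : ℚ → Set)
    (G-closed : ∀ {x y} → G x → IsInt y → G (x + y))
    (F-step : ∀ {x} → G x → F x ⇔ F (x + 1ℚ)) where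

  open SetoidReasoning (⇔-setoid 0ℓ)

  F-translate-ℕ : ∀ {x} n → G x → F x ⇔ F (x + ι n)
  F-translate-ℕ {x} zero    gx = begin
    F x                    ≡⟨ cong F (ℚP.+-identityʳ x) ⟨
    F (x + ι 0)            ∎
  F-translate-ℕ {x} (suc n) gx = begin
    F x                    ≈⟨ F-translate-ℕ n gx ⟩
    F (x + ι n)            ≈⟨ F-step (G-closed gx (IsInt-ι n)) ⟩
    F ((x + ι n) + 1ℚ)     ≡⟨ cong F (trans ([x+y]+1≡x+[1+y] x (ι n)) (cong (λ t → x + t) (sym (ι-suc n)))) ⟩
    F (x + ι (suc n))      ∎

  F-translate : ∀ {x r} → G x → IsInt (x - r) → F x ⇔ F r
  F-translate {x} {r} gx x-r∈ℤ with integer-difference x-r∈ℤ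
  ... | inj₁ (n , x≡r+n) = begin
    F x            ≡⟨ cong F x≡r+n ⟩
    F (r + ι n)    ≈⟨ F-translate-ℕ n (closed-translate G G-closed gx x-r∈ℤ) ⟨
    F r            ∎
  ... | inj₂ (n , r≡x+1+n) = begin
    F x                 ≈⟨ F-translate-ℕ (suc n) gx ⟩
    F (x + ι (suc n))   ≡⟨ cong F r≡x+1+n ⟨
    F r                 ∎

module ParameterTranslation {p : ℕ} (p-prime : Prime p) where
  open CoefficientValuations p-prime
  open SetoidReasoning (⇔-setoid 0ℓ)

  Unbounded-swap : ∀ a b c → Unbounded (w a b c) ⇔ Unbounded (w b a c)
  Unbounded-swap a b c = Unbounded-cong λ m → cong (λ z → v (z * inv (poch c m * fact m))) (ℚP.*-comm (poch a m) (poch b m))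
    where open Valuation p-prime using (v)

  translate-a : ∀ {a b c r} → Admissible a b c → IsInt (a - r) → Unbounded (w a b c) ⇔ Unbounded (w r b c)
  translate-a {b = b} {c} = A.F-translate
    where module A = IntegerTranslation (λ x → Admissible x b c) (λ x → Unbounded (w x b c))
                                         admissible-+a (λ adm → UnitSteps.a⇔a+1 p-prime adm)

  translate-c : ∀ {a b c t} → Admissible a b c → IsInt (c - t) → Unbounded (w a b c) ⇔ Unbounded (w a b t)
  translate-c {a} {b} = C.F-translate
    where module C = IntegerTranslation (λ x → Admissible a b x) (λ x → Unbounded (w a b x))
                                         admissible-+c (λ adm → UnitSteps.c⇔c+1 p-prime adm)

  translate-b : ∀ {a b c s} → Admissible a b c → IsInt (b - s) → Unbounded (w a b c) ⇔ Unbounded (w a s c)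
  translate-b {a} {b} {c} {s} adm b-s∈ℤ = begin
    Unbounded (w a b c)    ≈⟨ Unbounded-swap a b c ⟩
    Unbounded (w b a c)    ≈⟨ translate-a (admissible-swap adm) b-s∈ℤ ⟩
    Unbounded (w s a c)    ≈⟨ Unbounded-swap s a c ⟩
    Unbounded (w a s c)    ∎

lemma4p1 : (a b c r s t : ℚ) →
    ¬ IsInt a → ¬ IsInt b → ¬ IsInt c → ¬ IsInt (a - c) → ¬ IsInt (b - c) →
    IsInt (a - r) → IsInt (b - s) → IsInt (c - t) →
    (p : ℕ) → Prime p →
    PAdicallyUnbounded p (coeff2F1 a b c) ⇔ PAdicallyUnbounded p (coeff2F1 r s t)
lemma4p1 a b c r s t a∉ℤ b∉ℤ c∉ℤ a-c∉ℤ b-c∉ℤ a-r∈ℤ b-s∈ℤ c-t∈ℤ p p-prime = begin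
  PAdicallyUnbounded p (coeff2F1 a b c)   ≈⟨ padicallyUnbounded⇔ (coeff2F1 a b c) ⟩
  Unbounded (w a b c)                     ≈⟨ translate-a abc a-r∈ℤ ⟩
  Unbounded (w r b c)                     ≈⟨ translate-b rbc b-s∈ℤ ⟩
  Unbounded (w r s c)                     ≈⟨ translate-c rsc c-t∈ℤ ⟩
  Unbounded (w r s t)                     ≈⟨ padicallyUnbounded⇔ (coeff2F1 r s t) ⟨
  PAdicallyUnbounded p (coeff2F1 r s t)   ∎
  where
  open Valuation p-prime using (padicallyUnbounded⇔)
  open CoefficientValuations p-prime using (w)
  open ParameterTranslation p-prime
  open SetoidReasoning (⇔-setoid 0ℓ)
  abc : Admissible a b c
  abc = record { a∉ℤ = a∉ℤ ; b∉ℤ = b∉ℤ ; c∉ℤ = c∉ℤ ; a-c∉ℤ = a-c∉ℤ ; b-c∉ℤ = b-c∉ℤ }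
  rbc : Admissible r b c
  rbc = admissible-retarget-a abc a-r∈ℤ
  rsc : Admissible r s c
  rsc = admissible-retarget-b rbc b-s∈ℤ
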